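{- Let $G$ be a graph and let $\{K_1,K_2\}$ be an odd pair of cliques of $G$ such that $K_2$ is a maximal clique of $G$. Let $K_1'\neq K_1$ be a (nonempty) sub-clique of $K_1$. If $\{K_1', K_2\}$ is an odd pair of cliques, then $G$ has a star cutset.
   Context: Graphs are finite, simple, undirected and loopless; cliques are nonempty sets of pairwise adjacent vertices. For two cliques $K_1,K_2$ of $G$, an induced (chordless) path $P$ is external from $K_1$ to $K_2$ if one end-vertex is in $K_1$, the other is in $K_2$, and all other vertices are in $V(G)\setminus(K_1\cup K_2)$. $\{K_1,K_2\}$ is an odd pair of cliques if every external induced path between them has odd length (number of edges). A star cutset of $G$ is a set $C\subseteq V(G)$ such that $G\setminus C$ is disconnected and some vertex of $C$ is adjacent to all other vertices of $C$. -}

module Defs where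

open import Data.Nat using (ℕ; zero; suc; _<_; _%_)
open import Data.Bool using (Bool; true; false; T)
open import Data.Fin using (Fin; toℕ; fromℕ)
open import Data.Fin.Subset using (Subset; _∈_; _∉_; _⊆_)
open import Data.Product using (Σ; ∃; _×_; _,_)
open import Relation.Nullary using (¬_)
open import Relation.Binary.PropositionalEquality using (_≡_; _≢_)
open import Function.Definitions using (Injective)

record Graph : Set where
  field
    n      : ℕ
    adj    : Fin n → Fin n → Bool
    sym    : ∀ u v → adj u v ≡ adj v u
    irrefl : ∀ v → adj v v ≡ false

module _ (G : Graph) where
  open Graph G

  Adj : Fin n → Fin n → Set
  Adj u v = T (adj u v)

  IsClique : Subset n → Set
  IsClique K = (∃ λ v → v ∈ K) × (∀ u v → u ∈ K → v ∈ K → u ≢ v → Adj u v)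

  IsMaximalClique : Subset n → Set
  IsMaximalClique K = IsClique K × (∀ K′ → IsClique K′ → K ⊆ K′ → K′ ⊆ K)

  -- p : Fin (suc k) → Fin n is an induced (chordless) path of length k
  -- (k edges) with vertices p 0, p 1, ..., p k.
  IsInducedPath : (k : ℕ) → (Fin (suc k) → Fin n) → Set
  IsInducedPath k p =
    Injective _≡_ _≡_ p
    × (∀ i j → toℕ j ≡ suc (toℕ i) → Adj (p i) (p j))
    × (∀ i j → suc (toℕ i) < toℕ j → ¬ Adj (p i) (p j))

  -- external induced path from K₁ to K₂ (read with p 0 ∈ K₁, p k ∈ K₂;
  -- the reverse orientation is obtained by reversing the path)
  IsExternalPath : Subset n → Subset n → (k : ℕ) → (Fin (suc k) → Fin n) → Set
  IsExternalPath K₁ K₂ k p =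
    IsInducedPath k p
    × p Data.Fin.zero ∈ K₁
    × p (fromℕ k) ∈ K₂
    × (∀ i → 0 < toℕ i → toℕ i < k → p i ∉ K₁ × p i ∉ K₂)

  Odd : ℕ → Set
  Odd k = k % 2 ≡ 1

  IsOddPair : Subset n → Subset n → Set
  IsOddPair K₁ K₂ =
    IsClique K₁ × IsClique K₂
    × (∀ k p → IsExternalPath K₁ K₂ k p → Odd k)

  data ConnectedOutside (C : Subset n) : Fin n → Fin n → Set where
    here : ∀ {v} → v ∉ C → ConnectedOutside C v v
    step : ∀ {u w v} → u ∉ C → Adj u w → ConnectedOutside C w v →
           ConnectedOutside C u v

  Disconnects : Subset n → Set
  Disconnects C = Σ (Fin n) λ u → Σ (Fin n) λ v →
    u ∉ C × v ∉ C × ¬ ConnectedOutside C u v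

  IsStarCutset : Subset n → Set
  IsStarCutset C =
    Disconnects C × (∃ λ x → x ∈ C × (∀ y → y ∈ C → y ≢ x → Adj x y))

  HasStarCutset : Set
  HasStarCutset = ∃ IsStarCutset

-- Pick a ∈ K₁′ and x ∈ K₁ ∖ K₁′, and let C be the closed neighbourhood of a
-- without x: a star centred at a.  Odd pairs are disjoint, so a ∉ K₂, and by
-- maximality K₂ has a vertex z not adjacent to a.  If x and z were connected
-- in G ∖ C, a shortest path x … z′ from x to K₂ would be chordless and, apart
-- from x, avoid the closed neighbourhood of a; it is then an external path
-- from K₁ to K₂, and with a put in front an external path from K₁′ to K₂ one
-- edge longer.  Both lengths cannot be odd.
module Submission where

open import Defs
open import Data.Bool using (T)
open import Data.Fin as Fin using (Fin; toℕ; fromℕ; _≟_)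
open import Data.Fin.Properties using (toℕ-injective; toℕ≤pred[n]; toℕ-fromℕ; ¬∀⟶∃¬)
open import Data.Fin.Subset using (Subset; _∈_; _∉_; _⊆_; _⊂_; _∪_; ⁅_⁆)
open import Data.Fin.Subset.Properties using (_∈?_; ⊆-antisym; x∈⁅x⁆; x∈⁅y⁆⇒x≡y; x∈p∪q⁺; x∈p∪q⁻)
open import Data.Nat using (ℕ; zero; suc; pred; _+_; _%_; _≤_; _<_; z≤n; s≤s; s≤s⁻¹; _≤?_; _<?_)
open import Data.Nat.Induction using (<-rec)
open import Data.Nat.Properties
  using (≤-trans; <-≤-trans; <⇒≤; <-trans; n<1+n; <⇒≱; m≤m+n; m<m+n; +-suc;
         +-monoˡ-≤; +-monoˡ-<; m≤n⇒∃[o]m+o≡n; m≤n⇒m<n∨m≡n; <-cmp; anyUpTo?)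
open import Data.Nat.Tactic.RingSolver using (solve-∀)
open import Data.Product using (∃; ∃₂; _×_; _,_; proj₁; proj₂)
open import Data.Sum using (_⊎_; inj₁; inj₂)
open import Data.Vec using (tabulate)
open import Data.Vec.Functional using (_∷_)
open import Data.Vec.Properties using (lookup∘tabulate; []=⇒lookup; lookup⇒[]=)
open import Function using (_∘_)
open import Relation.Nullary using (¬_; Dec; does; yes; no; contradiction)
open import Relation.Nullary.Decidable using (T?; dec-true; _×-dec_; _⊎-dec_; _→-dec_; ¬?)
open import Relation.Binary.Definitions using (tri<; tri≈; tri>)
open import Relation.Binary.PropositionalEquality using (_≡_; _≢_; refl; sym; trans; cong; subst)

module _ {n : ℕ} {P : Fin n → Set} (P? : ∀ v → Dec (P v)) where

  subset : Subset n
  subset = tabulate (λ v → does (P? v))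

  ∈-subset⁺ : ∀ {v} → P v → v ∈ subset
  ∈-subset⁺ {v} pv = lookup⇒[]= v subset (trans (lookup∘tabulate _ v) (dec-true (P? v) pv))

  ∈-subset⁻ : ∀ {v} → v ∈ subset → P v
  ∈-subset⁻ {v} v∈ with P? v | trans (sym (lookup∘tabulate _ v)) ([]=⇒lookup v∈)
  ... | yes pv | _ = pv
  ... | no _ | ()

∃∈∧¬ : ∀ {n} {Q : Fin n → Set} (K : Subset n) → (∀ v → Dec (Q v)) →
  ¬ (∀ v → v ∈ K → Q v) → ∃ λ v → v ∈ K × ¬ Q v
∃∈∧¬ {n} {Q} K Q? ¬K⊆Q with ¬∀⟶∃¬ n (λ v → v ∈ K → Q v) (λ v → (v ∈? K) →-dec Q? v) ¬K⊆Q
... | v , ¬[v∈K→Qv] with v ∈? K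
...   | yes v∈K = v , v∈K , λ Qv → ¬[v∈K→Qv] (λ _ → Qv)
...   | no v∉K = contradiction (λ v∈K → contradiction v∈K v∉K) ¬[v∈K→Qv]

⊆∧≢⇒⊂ : ∀ {n} {p q : Subset n} → p ⊆ q → p ≢ q → p ⊂ q
⊆∧≢⇒⊂ {p = p} {q} p⊆q p≢q = p⊆q , ∃∈∧¬ q (_∈? p) (λ q⊆p → p≢q (⊆-antisym p⊆q (q⊆p _)))

odd⇒¬odd-suc : ∀ k → k % 2 ≡ 1 → suc k % 2 ≢ 1
odd⇒¬odd-suc (suc zero) _ ()
odd⇒¬odd-suc (suc (suc k)) = odd⇒¬odd-suc k

splice : {A : Set} → (ℕ → A) → ℕ → ℕ → ℕ → A
splice w i d m with m ≤? i
... | yes _ = w m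
... | no _ = w (m + d)

splice-≤ : ∀ {A : Set} (w : ℕ → A) {i d m} → m ≤ i → splice w i d m ≡ w m
splice-≤ w {i} {m = m} m≤i with m ≤? i
... | yes _ = refl
... | no m≰i = contradiction m≤i m≰i

splice-> : ∀ {A : Set} (w : ℕ → A) {i d m} → i < m → splice w i d m ≡ w (m + d)
splice-> w {i} {m = m} i<m with m ≤? i
... | yes m≤i = contradiction m≤i (<⇒≱ i<m)
... | no _ = refl

module _ (G : Graph) where
  open Graph G using (n; adj)

  Adj? : ∀ u v → Dec (Adj G u v)
  Adj? u v = T? (adj u v)

  Adj-sym : ∀ {u v} → Adj G u v → Adj G v u
  Adj-sym {u} {v} = subst T (Graph.sym G u v)

  infix 4 _∈N[_] _∈N[_]?

  _∈N[_] : Fin n → Fin n → Set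
  v ∈N[ a ] = v ≡ a ⊎ Adj G a v

  _∈N[_]? : ∀ v a → Dec (v ∈N[ a ])
  v ∈N[ a ]? = (v ≟ a) ⊎-dec Adj? a v

  clique⊆N : ∀ {K a v} → IsClique G K → a ∈ K → v ∈ K → v ∈N[ a ]
  clique⊆N {v = v} (_ , pairwise) a∈K v∈K with v ≟ _
  ... | yes v≡a = inj₁ v≡a
  ... | no v≢a = inj₂ (pairwise _ v a∈K v∈K (v≢a ∘ sym))

  ExternalPathsOdd : Subset n → Subset n → Set
  ExternalPathsOdd K₁ K₂ = ∀ k p → IsExternalPath G K₁ K₂ k p → Odd G k

  externalPathsOdd⇒disjoint : ∀ {K₁ K₂ v} → ExternalPathsOdd K₁ K₂ → v ∈ K₁ → v ∉ K₂
  externalPathsOdd⇒disjoint {v = v} odd v∈K₁ v∈K₂ =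
    contradiction (odd 0 (λ _ → v) (trivial , v∈K₁ , v∈K₂ , λ { Fin.zero () _ })) λ ()
    where
    trivial : IsInducedPath G 0 (λ _ → v)
    trivial = (λ { {Fin.zero} {Fin.zero} _ → refl })
            , (λ { Fin.zero Fin.zero () })
            , (λ { Fin.zero Fin.zero () })

  clique∪⁅⁆ : ∀ {K a} → IsClique G K → (∀ v → v ∈ K → v ∈N[ a ]) → IsClique G (K ∪ ⁅ a ⁆)
  clique∪⁅⁆ {K} {a} (_ , pairwise) K⊆N =
    (a , x∈p∪q⁺ (inj₂ (x∈⁅x⁆ a))) , λ u v u∈ v∈ → adjacent (x∈p∪q⁻ K ⁅ a ⁆ u∈) (x∈p∪q⁻ K ⁅ a ⁆ v∈)
    where
    a~ : ∀ {u} → u ∈ K → u ≢ a → Adj G a u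
    a~ {u} u∈K u≢a with K⊆N u u∈K
    ... | inj₁ u≡a = contradiction u≡a u≢a
    ... | inj₂ a~u = a~u

    adjacent : ∀ {u v} → u ∈ K ⊎ u ∈ ⁅ a ⁆ → v ∈ K ⊎ v ∈ ⁅ a ⁆ → u ≢ v → Adj G u v
    adjacent (inj₁ u∈K) (inj₁ v∈K) u≢v = pairwise _ _ u∈K v∈K u≢v
    adjacent (inj₁ u∈K) (inj₂ v∈⁅a⁆) u≢v with x∈⁅y⁆⇒x≡y a v∈⁅a⁆
    ... | refl = Adj-sym (a~ u∈K u≢v)
    adjacent (inj₂ u∈⁅a⁆) (inj₁ v∈K) u≢v with x∈⁅y⁆⇒x≡y a u∈⁅a⁆
    ... | refl = a~ v∈K (u≢v ∘ sym)
    adjacent (inj₂ u∈⁅a⁆) (inj₂ v∈⁅a⁆) u≢v =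
      contradiction (trans (x∈⁅y⁆⇒x≡y a u∈⁅a⁆) (sym (x∈⁅y⁆⇒x≡y a v∈⁅a⁆))) u≢v

  maximalClique⇒nonNeighbour : ∀ {K a} → IsMaximalClique G K → a ∉ K →
    ∃ λ z → z ∈ K × ¬ z ∈N[ a ]
  maximalClique⇒nonNeighbour {K} {a} (K-clique , maximal) a∉K = ∃∈∧¬ K (_∈N[ a ]?) λ K⊆N →
    a∉K (maximal (K ∪ ⁅ a ⁆) (clique∪⁅⁆ K-clique K⊆N) (x∈p∪q⁺ ∘ inj₁) (x∈p∪q⁺ (inj₂ (x∈⁅x⁆ a))))

  ∷-isInducedPath : ∀ {k a} {p : Fin (suc k) → Fin n} → IsInducedPath G k p →
    (∀ f → a ≢ p f) → Adj G a (p Fin.zero) → (∀ f → 0 < toℕ f → ¬ Adj G a (p f)) →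
    IsInducedPath G (suc k) (a ∷ p)
  ∷-isInducedPath {k} {a} {p} (injective , consecutive , chordless) a∉p a~p₀ a≁p =
    injective′ , consecutive′ , chordless′
    where
    injective′ : ∀ {f g} → (a ∷ p) f ≡ (a ∷ p) g → f ≡ g
    injective′ {Fin.zero} {Fin.zero} _ = refl
    injective′ {Fin.zero} {Fin.suc g} eq = contradiction eq (a∉p g)
    injective′ {Fin.suc f} {Fin.zero} eq = contradiction (sym eq) (a∉p f)
    injective′ {Fin.suc f} {Fin.suc g} eq = cong Fin.suc (injective eq)

    consecutive′ : ∀ f g → toℕ g ≡ suc (toℕ f) → Adj G ((a ∷ p) f) ((a ∷ p) g)
    consecutive′ Fin.zero (Fin.suc g) eq =
      subst (λ h → Adj G a (p h)) (sym (toℕ-injective {j = Fin.zero} (cong pred eq))) a~p₀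
    consecutive′ (Fin.suc f) (Fin.suc g) eq = consecutive f g (cong pred eq)

    chordless′ : ∀ f g → suc (toℕ f) < toℕ g → ¬ Adj G ((a ∷ p) f) ((a ∷ p) g)
    chordless′ Fin.zero (Fin.suc g) (s≤s 0<g) = a≁p g 0<g
    chordless′ (Fin.suc f) (Fin.suc g) (s≤s lt) = chordless f g lt

  -- Walks are indexed by ℕ; the values of w beyond the length k are irrelevant.
  record IsWalk (R : Fin n → Set) (k : ℕ) (w : ℕ → Fin n) : Set where
    field
      inside : ∀ i → i ≤ k → R (w i)
      edge   : ∀ i → i < k → Adj G (w i) (w (suc i))
  open IsWalk

  IsChordless : ℕ → (ℕ → Fin n) → Set
  IsChordless k w =
    (∀ i j → i < j → j ≤ k → w i ≢ w j) × (∀ i j → suc i < j → j ≤ k → ¬ Adj G (w i) (w j))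

  -- w i is adjacent to w (i+d+2), so cutting out the d+1 vertices in between
  -- leaves a walk of length k′.
  record Shortcut (k : ℕ) (w : ℕ → Fin n) : Set where
    constructor shortcut
    field
      {i d k′} : ℕ
      length   : k ≡ k′ + suc d
      i<k′     : i < k′
      jump     : Adj G (w i) (w (suc i + suc d))

  shortcut-shorter : ∀ {k w} (s : Shortcut k w) → Shortcut.k′ s < k
  shortcut-shorter (shortcut {d = d} {k′} refl _ _) = m<m+n k′ (s≤s z≤n)

  chord⇒shortcut : ∀ {k w i j} → suc i < j → j ≤ k → Adj G (w i) (w j) → Shortcut k w
  chord⇒shortcut {w = w} {i} 1+i<j j≤k chord with m≤n⇒∃[o]m+o≡n 1+i<j | m≤n⇒∃[o]m+o≡n j≤k
  ... | e , refl | r , refl =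
    shortcut {k′ = suc i + r} (length i e r) (s≤s (m≤m+n i r))
      (subst (λ j → Adj G (w i) (w j)) (sym (+-suc (suc i) e)) chord)
    where
    length : ∀ i e r → suc (suc i) + e + r ≡ suc i + r + suc e
    length = solve-∀

  module _ {R : Fin n → Set} where

    prefix : ∀ {k w i} → IsWalk R k w → i ≤ k → IsWalk R i w
    prefix W i≤k = record
      { inside = λ j j≤i → inside W j (≤-trans j≤i i≤k)
      ; edge = λ j j<i → edge W j (<-≤-trans j<i i≤k) }

    chordless⇒isInducedPath : ∀ {k w} → IsWalk R k w → IsChordless k w →
      IsInducedPath G k (w ∘ toℕ)
    chordless⇒isInducedPath {k} {w} W (injective , chordless) =
      injective′ , consecutive , chordless′
      where
      injective′ : ∀ {f g} → w (toℕ f) ≡ w (toℕ g) → f ≡ g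
      injective′ {f} {g} eq with <-cmp (toℕ f) (toℕ g)
      ... | tri< f<g _ _ = contradiction eq (injective _ _ f<g (toℕ≤pred[n] g))
      ... | tri≈ _ f≡g _ = toℕ-injective f≡g
      ... | tri> _ _ g<f = contradiction (sym eq) (injective _ _ g<f (toℕ≤pred[n] f))

      consecutive : ∀ f g → toℕ g ≡ suc (toℕ f) → Adj G (w (toℕ f)) (w (toℕ g))
      consecutive f g eq =
        subst (λ j → Adj G (w (toℕ f)) (w j)) (sym eq) (edge W _ (subst (_≤ k) eq (toℕ≤pred[n] g)))

      chordless′ : ∀ f g → suc (toℕ f) < toℕ g → ¬ Adj G (w (toℕ f)) (w (toℕ g))
      chordless′ f g lt = chordless _ _ lt (toℕ≤pred[n] g)

    shorten : ∀ {k w} → IsWalk R k w → (s : Shortcut k w) →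
      let open Shortcut s in IsWalk R k′ (splice w i (suc d))
    shorten {w = w} W (shortcut {i} {d} {k′} refl i<k′ jump) =
      record { inside = inside′ ; edge = edge′ }
      where
      inside′ : ∀ m → m ≤ k′ → R (splice w i (suc d) m)
      inside′ m m≤k′ with m ≤? i
      ... | yes _ = inside W m (≤-trans m≤k′ (m≤m+n k′ (suc d)))
      ... | no _ = inside W (m + suc d) (+-monoˡ-≤ (suc d) m≤k′)

      edge′ : ∀ m → m < k′ → Adj G (splice w i (suc d) m) (splice w i (suc d) (suc m))
      edge′ m m<k′ with m ≤? i | suc m ≤? i
      ... | yes _ | yes _ = edge W m (<-≤-trans m<k′ (m≤m+n k′ (suc d)))
      ... | yes m≤i | no m≮i with m≤n⇒m<n∨m≡n m≤i
      ...   | inj₁ m<i = contradiction m<i m≮i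
      ...   | inj₂ refl = jump
      edge′ m m<k′ | no m≰i | yes m<i = contradiction (<⇒≤ m<i) m≰i
      edge′ m m<k′ | no _ | no _ = edge W (m + suc d) (+-monoˡ-< (suc d) m<k′)

    repeat⇒shortcut : ∀ {k w i j} → IsWalk R k w → i < j → j < k → w i ≡ w j → Shortcut k w
    repeat⇒shortcut {w = w} {j = j} W i<j j<k wi≡wj =
      chord⇒shortcut (s≤s i<j) j<k (subst (λ u → Adj G u (w (suc j))) (sym wi≡wj) (edge W j j<k))

    chordless-or-shortcut : ∀ {k w} → IsWalk R k w → (∀ i → i < k → w i ≢ w k) →
      Shortcut k w ⊎ IsChordless k w
    chordless-or-shortcut {k} {w} W last-unrepeated
      with anyUpTo? (λ j → anyUpTo? (λ i → defect? i j) j) (suc k)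
      where
      defect? : ∀ i j → Dec (w i ≡ w j ⊎ (suc i < j × Adj G (w i) (w j)))
      defect? i j = (w i ≟ w j) ⊎-dec ((suc i <? j) ×-dec Adj? (w i) (w j))
    ... | yes (j , j<1+k , i , i<j , inj₂ (1+i<j , chord)) =
      inj₁ (chord⇒shortcut 1+i<j (s≤s⁻¹ j<1+k) chord)
    ... | yes (j , j<1+k , i , i<j , inj₁ wi≡wj) with m≤n⇒m<n∨m≡n (s≤s⁻¹ j<1+k)
    ...   | inj₁ j<k = inj₁ (repeat⇒shortcut W i<j j<k wi≡wj)
    ...   | inj₂ refl = contradiction wi≡wj (last-unrepeated i i<j)
    chordless-or-shortcut W _ | no none =
      inj₂ ( (λ i j i<j j≤k wi≡wj → none (j , s≤s j≤k , i , i<j , inj₁ wi≡wj))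
           , λ i j 1+i<j j≤k chord →
               none (j , s≤s j≤k , i , <-trans (n<1+n i) 1+i<j , inj₂ (1+i<j , chord)))

    record InducedWalk (s : Fin n) (T : Subset n) : Set where
      field
        length    : ℕ
        vertex    : ℕ → Fin n
        walk      : IsWalk R length vertex
        start     : vertex 0 ≡ s
        end       : vertex length ∈ T
        first     : ∀ i → i < length → vertex i ∉ T
        chordless : IsChordless length vertex

    inducedWalk : ∀ {T} k w → IsWalk R k w → w k ∈ T → InducedWalk (w 0) T
    inducedWalk {T} = <-rec (λ k → ∀ w → IsWalk R k w → w k ∈ T → InducedWalk (w 0) T) go
      where
      go : ∀ k → (∀ {k′} → k′ < k → ∀ w → IsWalk R k′ w → w k′ ∈ T → InducedWalk (w 0) T) →
        ∀ w → IsWalk R k w → w k ∈ T → InducedWalk (w 0) T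
      go k shorter w W end with anyUpTo? (λ i → w i ∈? T) k
      ... | yes (i , i<k , wi∈T) = shorter i<k w (prefix W (<⇒≤ i<k)) wi∈T
      ... | no first
        with chordless-or-shortcut W (λ i i<k wi≡wk → first (i , i<k , subst (_∈ T) (sym wi≡wk) end))
      ...   | inj₂ chordless = record
        { length = k ; vertex = w ; walk = W ; start = refl ; end = end
        ; first = λ i i<k wi∈T → first (i , i<k , wi∈T) ; chordless = chordless }
      ...   | inj₁ s@(shortcut {i} {d} refl i<k′ _) =
        subst (λ u → InducedWalk u T) (splice-≤ w {i} {suc d} z≤n)
          (shorter (shortcut-shorter s) (splice w i (suc d)) (shorten W s)
            (subst (_∈ T) (sym (splice-> w i<k′)) end))

  connected⇒walk : ∀ {C u v} → ConnectedOutside G C u v →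
    ∃₂ λ k w → IsWalk (_∉ C) k w × w 0 ≡ u × w k ≡ v
  connected⇒walk {v = v} (here v∉C) =
    0 , (λ _ → v) , record { inside = λ _ _ → v∉C ; edge = λ _ () } , refl , refl
  connected⇒walk {C} {u} (step u∉C u~w rest) with connected⇒walk rest
  ... | k , w , W , w₀≡ , wₖ≡v =
    suc k , u◂w , record { inside = inside′ ; edge = edge′ } , refl , wₖ≡v
    where
    u◂w : ℕ → Fin n
    u◂w zero = u
    u◂w (suc i) = w i

    inside′ : ∀ i → i ≤ suc k → u◂w i ∉ C
    inside′ zero _ = u∉C
    inside′ (suc i) 1+i≤1+k = inside W i (s≤s⁻¹ 1+i≤1+k)

    edge′ : ∀ i → i < suc k → Adj G (u◂w i) (u◂w (suc i))
    edge′ zero _ = subst (Adj G u) (sym w₀≡) u~w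
    edge′ (suc i) 1+i<1+k = edge W i (s≤s⁻¹ 1+i<1+k)

  module StarCutset {K₁ K₂ K₁′ : Subset n}
    (odd : ExternalPathsOdd K₁ K₂) (odd′ : ExternalPathsOdd K₁′ K₂)
    (K₁-clique : IsClique G K₁) (K₁′⊆K₁ : K₁′ ⊆ K₁)
    {a x : Fin n} (a∈K₁′ : a ∈ K₁′) (x∈K₁ : x ∈ K₁) (x∉K₁′ : x ∉ K₁′) where

    C? : ∀ v → Dec (v ∈N[ a ] × v ≢ x)
    C? v = (v ∈N[ a ]?) ×-dec ¬? (v ≟ x)

    C : Subset n
    C = subset C?

    a≢x : a ≢ x
    a≢x refl = x∉K₁′ a∈K₁′

    K₁⊆N[a] : ∀ {v} → v ∈ K₁ → v ∈N[ a ]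
    K₁⊆N[a] = clique⊆N K₁-clique (K₁′⊆K₁ a∈K₁′)

    no-inducedWalk : ¬ InducedWalk {_∉ C} x K₂
    no-inducedWalk shortest = odd⇒¬odd-suc k (odd k p path) (odd′ (suc k) (a ∷ p) path′)
      where
      open InducedWalk shortest renaming (length to k; vertex to w)

      p : Fin (suc k) → Fin n
      p = w ∘ toℕ

      far : ∀ i → 0 < i → i ≤ k → ¬ w i ∈N[ a ]
      far i 0<i i≤k wi∈N = inside walk i i≤k
        (∈-subset⁺ C? (wi∈N , λ wi≡x → proj₁ chordless 0 i 0<i i≤k (trans start (sym wi≡x))))

      a≢w : ∀ i → i ≤ k → a ≢ w i
      a≢w zero _ a≡w₀ = a≢x (trans a≡w₀ start)
      a≢w (suc i) 1+i≤k a≡w = far (suc i) (s≤s z≤n) 1+i≤k (inj₁ (sym a≡w))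

      w∉K₁′ : ∀ i → i ≤ k → w i ∉ K₁′
      w∉K₁′ zero _ w₀∈K₁′ = x∉K₁′ (subst (_∈ K₁′) start w₀∈K₁′)
      w∉K₁′ (suc i) 1+i≤k wi∈K₁′ = far (suc i) (s≤s z≤n) 1+i≤k (K₁⊆N[a] (K₁′⊆K₁ wi∈K₁′))

      induced : IsInducedPath G k p
      induced = chordless⇒isInducedPath walk chordless

      end′ : p (fromℕ k) ∈ K₂
      end′ = subst (λ j → w j ∈ K₂) (sym (toℕ-fromℕ k)) end

      path : IsExternalPath G K₁ K₂ k p
      path = induced , subst (_∈ K₁) (sym start) x∈K₁ , end′ , λ f 0<f f<k →
        (λ pf∈K₁ → far _ 0<f (<⇒≤ f<k) (K₁⊆N[a] pf∈K₁)) , first _ f<k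

      path′ : IsExternalPath G K₁′ K₂ (suc k) (a ∷ p)
      path′ = ∷-isInducedPath induced (λ f → a≢w _ (toℕ≤pred[n] f))
                (subst (Adj G a) (sym start) (proj₂ K₁-clique a x (K₁′⊆K₁ a∈K₁′) x∈K₁ a≢x))
                (λ f 0<f → far _ 0<f (toℕ≤pred[n] f) ∘ inj₂)
            , a∈K₁′ , end′
            , λ { Fin.zero () _ ; (Fin.suc f) _ (s≤s f<k) → w∉K₁′ _ (<⇒≤ f<k) , first _ f<k }

    hasStarCutset : ∀ {z} → z ∈ K₂ → ¬ z ∈N[ a ] → HasStarCutset G
    hasStarCutset {z} z∈K₂ z∉N = C , (x , z , x∉C , z∉C , separated) , a , a∈C , star
      where
      x∉C : x ∉ C
      x∉C x∈C = proj₂ (∈-subset⁻ C? x∈C) refl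

      z∉C : z ∉ C
      z∉C z∈C = z∉N (proj₁ (∈-subset⁻ C? z∈C))

      a∈C : a ∈ C
      a∈C = ∈-subset⁺ C? (inj₁ refl , a≢x)

      star : ∀ y → y ∈ C → y ≢ a → Adj G a y
      star y y∈C y≢a with proj₁ (∈-subset⁻ C? y∈C)
      ... | inj₁ y≡a = contradiction y≡a y≢a
      ... | inj₂ a~y = a~y

      separated : ¬ ConnectedOutside G C x z
      separated connected with connected⇒walk connected
      ... | k , w , W , w₀≡x , wₖ≡z = no-inducedWalk
        (subst (λ u → InducedWalk u K₂) w₀≡x (inducedWalk k w W (subst (_∈ K₂) (sym wₖ≡z) z∈K₂)))

mainTheorem6 : (G : Graph) → (K₁ K₂ K₁′ : Subset (Graph.n G)) →
    IsOddPair G K₁ K₂ → IsMaximalClique G K₂ →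
    IsClique G K₁′ → K₁′ ⊆ K₁ → K₁′ ≢ K₁ →
    IsOddPair G K₁′ K₂ → HasStarCutset G
mainTheorem6 G K₁ K₂ K₁′ (K₁-clique , _ , odd) K₂-maximal ((a , a∈K₁′) , _) K₁′⊆K₁ K₁′≢K₁
  (_ , _ , odd′)
  with ⊆∧≢⇒⊂ K₁′⊆K₁ K₁′≢K₁
... | _ , x , x∈K₁ , x∉K₁′
  with maximalClique⇒nonNeighbour G K₂-maximal (externalPathsOdd⇒disjoint G odd (K₁′⊆K₁ a∈K₁′))
... | z , z∈K₂ , z∉N[a] =
  StarCutset.hasStarCutset G odd odd′ K₁-clique K₁′⊆K₁ a∈K₁′ x∈K₁ x∉K₁′ z∈K₂ z∉N[a]
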